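{- For every integer $k\ge 2$, the class $\mathcal{C}_k$ is closed under homomorphic pre-images: if $G\in\mathcal{C}_k$ and $H$ is a finite graph with a graph homomorphism $H\to G$, then $H\in\mathcal{C}_k$.
   Context: A circular ordering of a finite set $X$ is a ternary relation $C\subseteq X^3$ such that for all $x,y,z,w\in X$: $(x,y,z)\in C\Rightarrow(y,z,x)\in C$; $(x,y,z)\in C\Rightarrow(x,z,y)\notin C$; $(x,y,z),(x,z,w)\in C\Rightarrow(x,y,w)\in C$; and for distinct $x,y,z$ either $(x,y,z)\in C$ or $(x,z,y)\in C$. For $n\ge2$ and a graph $G$ with circular ordering $C$ of $V(G)$, write $SP_n\to(G,C)$ if there exist vertices $u_1,\dots,u_n$ with $u_iu_{i+1}\in E(G)$ for $1\le i\le n-1$, $u_1,\dots,u_{n-1}$ pairwise distinct with $(u_1,u_i,u_j)\in C$ whenever $1<i<j\le n-1$, and either $u_n=u_1$ or ($u_n\notin\{u_1,\dots,u_{n-1}\}$ and $(u_{n-1},u_n,u_1)\in C$). $\mathcal{C}_n$ is the class of finite simple graphs $G$ admitting a circular ordering $C$ of $V(G)$ with $SP_n\not\to(G,C)$. -}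

module Defs where

open import Level using (0ℓ)
open import Data.Nat using (ℕ; zero; suc; _≤_)
open import Data.Fin using (Fin; zero; suc; inject₁; fromℕ; _<_)
open import Data.Product using (Σ; _×_; _,_)
open import Data.Sum using (_⊎_)
open import Data.Empty using (⊥)
open import Relation.Nullary using (¬_)
open import Relation.Binary.PropositionalEquality using (_≡_; _≢_)
open import Function.Definitions using (Injective)
open import Function using (_∋_)

record Graph : Set₁ where
  field
    n     : ℕ
    Adj   : Fin n → Fin n → Set
    sym   : ∀ {x y} → Adj x y → Adj y x
    irrefl : ∀ {x} → ¬ Adj x x

open Graph public

record Hom (H G : Graph) : Set where
  field
    map  : Fin (n H) → Fin (n G)
    pres : ∀ {x y} → Adj H x y → Adj G (map x) (map y)

record IsCircularOrdering {m : ℕ} (C : Fin m → Fin m → Fin m → Set) : Set where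
  field
    cyclic     : ∀ {x y z} → C x y z → C y z x
    asymmetric : ∀ {x y z} → C x y z → ¬ C x z y
    transitive : ∀ {x y z w} → C x y z → C x z w → C x y w
    total      : ∀ {x y z} → x ≢ y → y ≢ z → x ≢ z → C x y z ⊎ C x z y

CircularOrdering : ℕ → Set₁
CircularOrdering m = Σ (Fin m → Fin m → Fin m → Set) IsCircularOrdering

-- SP_k → (G , C) for k = suc (suc m) (so k ≥ 2).
-- The first k-1 = suc m vertices u₁,…,u_{k-1} are given by u : Fin (suc m) → V
-- (index 0 ↦ u₁), and the last vertex u_k is w.
SPmaps : (m : ℕ) (G : Graph) → (Fin (n G) → Fin (n G) → Fin (n G) → Set) → Set
SPmaps m G C =
  Σ (Fin (suc m) → Fin (n G)) λ u → Σ (Fin (n G)) λ w →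
      (∀ (i : Fin m) → Adj G (u (inject₁ i)) (u (suc i)))
    × Adj G (u (fromℕ m)) w
    × Injective {A = Fin (suc m)} _≡_ _≡_ u
    × (∀ (i j : Fin (suc m)) → (Fin (suc m) ∋ zero) < i → i < j → C (u zero) (u i) (u j))
    × (w ≡ u zero
       ⊎ ((∀ (i : Fin (suc m)) → w ≢ u i) × C (u (fromℕ m)) w (u zero)))

-- SP_k → (G , C), for k ≥ 2 (for k < 2 the notion is not defined in the paper; set to ⊥, unused)
SP : (k : ℕ) (G : Graph) → (Fin (n G) → Fin (n G) → Fin (n G) → Set) → Set
SP (suc (suc m)) G C = SPmaps m G C
SP _ G C = ⊥

InClass : (k : ℕ) → Graph → Set₁
InClass k G = Σ (CircularOrdering (n G)) λ C → ¬ SP k G (Data.Product.proj₁ C)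

-- Cut the circular order of G at a vertex and number V(G) by counting predecessors: the rank is
-- injective and induces the given cyclic order. Order V(H) cyclically by the key (rank of the
-- image, index), so that every fibre of the homomorphism is an interval; then of the two arcs
-- joining two keys of one fibre, one stays inside that fibre. For a witness of SP_k in H each such
-- arc contains an edge of the walk, whose ends lie in distinct fibres since fibres are independent.
-- Hence the walk visits distinct fibres, except that its final vertex may return to the fibre of
-- its start, and its image witnesses SP_k in G.
module Submission where

open import Defs hiding (sym)
open import Data.Nat using (ℕ; zero; suc; _≤_; _<_; _+_; _*_; s≤s; z<s; s<s; s≤s⁻¹)
open import Data.Nat.Properties
  using (<-trans; <-asym; <-irrefl; <-cmp; ≤-antisym; ≤-trans; ≤-reflexive; ≤∧≢⇒<; <⇒≱; ≮⇒≥;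
         +-comm; +-cancelˡ-≡; +-monoʳ-<; *-monoˡ-≤; m≤m+n; module ≤-Reasoning)
open import Data.Fin using (Fin; zero; suc; toℕ; inject₁; fromℕ)
import Data.Fin as Fin
import Data.Fin.Properties as Fin
open import Data.Fin.Relation.Unary.Top using (view; ‵fromℕ; ‵inject₁)
open import Data.Fin.Subset using (Subset; _∈_; _⊂_; ∣_∣)
open import Data.Fin.Subset.Properties using (p⊂q⇒∣p∣<∣q∣)
open import Data.Vec using (tabulate)
open import Data.Bool using (false; true)
open import Data.Vec.Properties using (lookup∘tabulate; lookup⇒[]=; []=⇒lookup)
open import Data.Product using (∃-syntax; _×_; _,_; proj₂)
open import Data.Sum using (_⊎_; inj₁; inj₂)
import Data.Sum as Sum
open import Data.Empty using (⊥-elim)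
open import Relation.Nullary using (¬_; Dec; yes; no; does)
open import Relation.Nullary.Decidable using (_×-dec_; _⊎-dec_; ¬?; dec-true; dec-false; decidable-stable)
open import Relation.Binary using (tri<; tri≈; tri>)
open import Relation.Binary.PropositionalEquality using (_≡_; _≢_; refl; sym; trans; cong; subst)
open import Function using (_∘_)
open import Function.Definitions using (Injective)

Cyclic : ℕ → ℕ → ℕ → Set
Cyclic x y z = (x < y × y < z) ⊎ (y < z × z < x) ⊎ (z < x × x < y)

Cyclic⟨_⟩ : ∀ {A : Set} → (A → ℕ) → A → A → A → Set
Cyclic⟨ f ⟩ a b c = Cyclic (f a) (f b) (f c)

cyclic-rotate : ∀ {x y z} → Cyclic x y z → Cyclic y z x
cyclic-rotate (inj₁ p)         = inj₂ (inj₂ p)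
cyclic-rotate (inj₂ (inj₁ p)) = inj₁ p
cyclic-rotate (inj₂ (inj₂ p)) = inj₂ (inj₁ p)

cyclic-asym : ∀ {x y z} → Cyclic x y z → ¬ Cyclic x z y
cyclic-asym (inj₁ (_ , y<z))         (inj₁ (_ , z<y))         = <-asym y<z z<y
cyclic-asym (inj₁ (_ , y<z))         (inj₂ (inj₁ (z<y , _))) = <-asym y<z z<y
cyclic-asym (inj₁ (x<y , _))         (inj₂ (inj₂ (y<x , _))) = <-asym x<y y<x
cyclic-asym (inj₂ (inj₁ (_ , z<x))) (inj₁ (x<z , _))         = <-asym z<x x<z
cyclic-asym (inj₂ (inj₁ (y<z , _))) (inj₂ (inj₁ (z<y , _))) = <-asym y<z z<y
cyclic-asym (inj₂ (inj₁ (_ , z<x))) (inj₂ (inj₂ (_ , x<z))) = <-asym z<x x<z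
cyclic-asym (inj₂ (inj₂ (z<x , _))) (inj₁ (x<z , _))         = <-asym z<x x<z
cyclic-asym (inj₂ (inj₂ (_ , x<y))) (inj₂ (inj₁ (_ , y<x))) = <-asym x<y y<x
cyclic-asym (inj₂ (inj₂ (_ , x<y))) (inj₂ (inj₂ (y<x , _))) = <-asym x<y y<x

cyclic-trans : ∀ {x y z w} → Cyclic x y z → Cyclic x z w → Cyclic x y w
cyclic-trans (inj₁ (x<y , y<z))         (inj₁ (_ , z<w))         = inj₁ (x<y , <-trans y<z z<w)
cyclic-trans (inj₁ (x<y , y<z))         (inj₂ (inj₁ (z<w , w<x))) = ⊥-elim (<-asym (<-trans x<y y<z) (<-trans z<w w<x))
cyclic-trans (inj₁ (x<y , _))           (inj₂ (inj₂ (w<x , _)))   = inj₂ (inj₂ (w<x , x<y))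
cyclic-trans (inj₂ (inj₁ (_ , z<x)))   (inj₁ (x<z , _))         = ⊥-elim (<-asym z<x x<z)
cyclic-trans (inj₂ (inj₁ (y<z , _)))   (inj₂ (inj₁ (z<w , w<x))) = inj₂ (inj₁ (<-trans y<z z<w , w<x))
cyclic-trans (inj₂ (inj₁ (_ , z<x)))   (inj₂ (inj₂ (_ , x<z)))   = ⊥-elim (<-asym z<x x<z)
cyclic-trans (inj₂ (inj₂ (z<x , _)))   (inj₁ (x<z , _))         = ⊥-elim (<-asym z<x x<z)
cyclic-trans (inj₂ (inj₂ (_ , x<y)))   (inj₂ (inj₁ (_ , w<x)))   = inj₂ (inj₂ (w<x , x<y))
cyclic-trans (inj₂ (inj₂ (z<x , _)))   (inj₂ (inj₂ (_ , x<z)))   = ⊥-elim (<-asym z<x x<z)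

cyclic-total : ∀ {x y z} → x ≢ y → y ≢ z → x ≢ z → Cyclic x y z ⊎ Cyclic x z y
cyclic-total {x} {y} {z} x≢y y≢z x≢z with <-cmp x y | <-cmp y z | <-cmp x z
... | tri≈ _ x≡y _ | _            | _            = ⊥-elim (x≢y x≡y)
... | _            | tri≈ _ y≡z _ | _            = ⊥-elim (y≢z y≡z)
... | _            | _            | tri≈ _ x≡z _ = ⊥-elim (x≢z x≡z)
... | tri< x<y _ _ | tri< y<z _ _ | _            = inj₁ (inj₁ (x<y , y<z))
... | tri< x<y _ _ | tri> _ _ z<y | tri< x<z _ _ = inj₂ (inj₁ (x<z , z<y))
... | tri< x<y _ _ | tri> _ _ z<y | tri> _ _ z<x = inj₁ (inj₂ (inj₂ (z<x , x<y)))
... | tri> _ _ y<x | tri< y<z _ _ | tri< x<z _ _ = inj₂ (inj₂ (inj₂ (y<x , x<z)))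
... | tri> _ _ y<x | tri< y<z _ _ | tri> _ _ z<x = inj₁ (inj₂ (inj₁ (y<z , z<x)))
... | tri> _ _ y<x | tri> _ _ z<y | _            = inj₂ (inj₂ (inj₁ (z<y , y<x)))

cyclic-isCircularOrdering : ∀ {k} {f : Fin k → ℕ} → Injective _≡_ _≡_ f → IsCircularOrdering Cyclic⟨ f ⟩
cyclic-isCircularOrdering f-injective = record
  { cyclic     = cyclic-rotate
  ; asymmetric = cyclic-asym
  ; transitive = cyclic-trans
  ; total      = λ x≢y y≢z x≢z → cyclic-total (x≢y ∘ f-injective) (y≢z ∘ f-injective) (x≢z ∘ f-injective)
  }

module CircularOrderingProperties {m : ℕ} {C : Fin m → Fin m → Fin m → Set}
                                  (isC : IsCircularOrdering C) where
  open IsCircularOrdering isC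

  C-irrefl₂₃ : ∀ {x y} → ¬ C x y y
  C-irrefl₂₃ c = asymmetric c c

  C-irrefl₁₃ : ∀ {x y} → ¬ C x y x
  C-irrefl₁₃ c = C-irrefl₂₃ (cyclic c)

  C⇒≢₁₂ : ∀ {x y z} → C x y z → x ≢ y
  C⇒≢₁₂ c refl = C-irrefl₂₃ (cyclic (cyclic c))

  C⇒≢₂₃ : ∀ {x y z} → C x y z → y ≢ z
  C⇒≢₂₃ c refl = C-irrefl₂₃ c

  C⇒≢₁₃ : ∀ {x y z} → C x y z → x ≢ z
  C⇒≢₁₃ c refl = C-irrefl₁₃ c

  C-shift : ∀ {a x z y} → C a x z → C a z y → C x z y
  C-shift c₁ c₂ with total (C⇒≢₂₃ c₁) (C⇒≢₂₃ c₂) (C⇒≢₂₃ (transitive c₁ c₂))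
  ... | inj₁ c = c
  ... | inj₂ c = ⊥-elim (asymmetric c₁ (cyclic (cyclic (transitive (cyclic (cyclic c)) (cyclic c₂)))))

  C? : ∀ x y z → Dec (C x y z)
  C? x y z with x Fin.≟ y | y Fin.≟ z | x Fin.≟ z
  ... | yes x≡y | _       | _       = no λ c → C⇒≢₁₂ c x≡y
  ... | no _    | yes y≡z | _       = no λ c → C⇒≢₂₃ c y≡z
  ... | no _    | no _    | yes x≡z = no λ c → C⇒≢₁₃ c x≡z
  ... | no x≢y  | no y≢z  | no x≢z  with total x≢y y≢z x≢z
  ...   | inj₁ c = yes c
  ...   | inj₂ c = no (asymmetric c)

  module CutAt (b : Fin m) where
    infix 4 _≺_ _≺?_

    _≺_ : Fin m → Fin m → Set
    x ≺ y = (x ≡ b × y ≢ b) ⊎ C b x y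

    ≺-irrefl : ∀ {x} → ¬ x ≺ x
    ≺-irrefl (inj₁ (x≡b , x≢b)) = x≢b x≡b
    ≺-irrefl (inj₂ c)           = C-irrefl₂₃ c

    ≺-trans : ∀ {x y z} → x ≺ y → y ≺ z → x ≺ z
    ≺-trans (inj₁ (_ , y≢b))   (inj₁ (y≡b , _)) = ⊥-elim (y≢b y≡b)
    ≺-trans (inj₁ (x≡b , _))   (inj₂ c)         = inj₁ (x≡b , C⇒≢₁₃ c ∘ sym)
    ≺-trans (inj₂ c)           (inj₁ (y≡b , _)) = ⊥-elim (C⇒≢₁₃ c (sym y≡b))
    ≺-trans (inj₂ c)           (inj₂ c′)        = inj₂ (transitive c c′)

    ≺-total : ∀ {x y} → x ≢ y → x ≺ y ⊎ y ≺ x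
    ≺-total {x} {y} x≢y with x Fin.≟ b | y Fin.≟ b
    ... | yes x≡b | _       = inj₁ (inj₁ (x≡b , λ y≡b → x≢y (trans x≡b (sym y≡b))))
    ... | no x≢b  | yes y≡b = inj₂ (inj₁ (y≡b , x≢b))
    ... | no x≢b  | no y≢b  with total (x≢b ∘ sym) x≢y (y≢b ∘ sym)
    ...   | inj₁ c = inj₁ (inj₂ c)
    ...   | inj₂ c = inj₂ (inj₂ c)

    _≺?_ : ∀ x y → Dec (x ≺ y)
    x ≺? y = (x Fin.≟ b ×-dec ¬? (y Fin.≟ b)) ⊎-dec C? b x y

    ≺-C : ∀ {x y z} → x ≺ y → y ≺ z → C x y z
    ≺-C (inj₁ (_ , y≢b)) (inj₁ (y≡b , _)) = ⊥-elim (y≢b y≡b)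
    ≺-C (inj₁ (refl , _)) (inj₂ c)        = c
    ≺-C (inj₂ c)         (inj₁ (y≡b , _)) = ⊥-elim (C⇒≢₁₃ c (sym y≡b))
    ≺-C (inj₂ c)         (inj₂ c′)        = C-shift c c′

    predecessors : Fin m → Subset m
    predecessors x = tabulate λ z → does (z ≺? x)

    ∈-predecessors⁺ : ∀ {z x} → z ≺ x → z ∈ predecessors x
    ∈-predecessors⁺ {z} {x} z≺x =
      lookup⇒[]= z _ (trans (lookup∘tabulate _ z) (dec-true (z ≺? x) z≺x))

    ∈-predecessors⁻ : ∀ {z x} → z ∈ predecessors x → z ≺ x
    ∈-predecessors⁻ {z} {x} z∈ = decidable-stable (z ≺? x) λ z⊀x →
      false≢true (trans (sym (dec-false (z ≺? x) z⊀x)) (trans (sym (lookup∘tabulate _ z)) ([]=⇒lookup z∈)))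
      where false≢true : false ≢ true
            false≢true ()

    ≺⇒predecessors⊂ : ∀ {x y} → x ≺ y → predecessors x ⊂ predecessors y
    ≺⇒predecessors⊂ {x} x≺y =
        (λ z∈ → ∈-predecessors⁺ (≺-trans (∈-predecessors⁻ z∈) x≺y))
      , x , ∈-predecessors⁺ x≺y , ≺-irrefl ∘ ∈-predecessors⁻

    rank : Fin m → ℕ
    rank x = ∣ predecessors x ∣

    ≺⇒rank< : ∀ {x y} → x ≺ y → rank x < rank y
    ≺⇒rank< = p⊂q⇒∣p∣<∣q∣ ∘ ≺⇒predecessors⊂

    rank-injective : Injective _≡_ _≡_ rank
    rank-injective {x} {y} rx≡ry with x Fin.≟ y
    ... | yes x≡y = x≡y
    ... | no x≢y  with ≺-total x≢y
    ...   | inj₁ x≺y = ⊥-elim (<-irrefl rx≡ry (≺⇒rank< x≺y))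
    ...   | inj₂ y≺x = ⊥-elim (<-irrefl (sym rx≡ry) (≺⇒rank< y≺x))

    rank<⇒≺ : ∀ {x y} → rank x < rank y → x ≺ y
    rank<⇒≺ {x} {y} rx<ry with x Fin.≟ y
    ... | yes refl = ⊥-elim (<-irrefl refl rx<ry)
    ... | no x≢y  with ≺-total x≢y
    ...   | inj₁ x≺y = x≺y
    ...   | inj₂ y≺x = ⊥-elim (<-asym rx<ry (≺⇒rank< y≺x))

    rank-cyclic : ∀ {x y z} → Cyclic⟨ rank ⟩ x y z → C x y z
    rank-cyclic (inj₁ (x<y , y<z))        = ≺-C (rank<⇒≺ x<y) (rank<⇒≺ y<z)
    rank-cyclic (inj₂ (inj₁ (y<z , z<x))) = cyclic (cyclic (≺-C (rank<⇒≺ y<z) (rank<⇒≺ z<x)))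
    rank-cyclic (inj₂ (inj₂ (z<x , x<y))) = cyclic (≺-C (rank<⇒≺ z<x) (rank<⇒≺ x<y))

record Linearization {m : ℕ} (C : Fin m → Fin m → Fin m → Set) : Set where
  field
    rank           : Fin m → ℕ
    rank-injective : Injective _≡_ _≡_ rank
    rank-cyclic    : ∀ {x y z} → Cyclic⟨ rank ⟩ x y z → C x y z

linearization : ∀ {m} {C : Fin m → Fin m → Fin m → Set} → IsCircularOrdering C → Linearization C
linearization {zero} _ = record
  { rank = λ () ; rank-injective = λ {x} → ⊥-elim (Fin.¬Fin0 x) ; rank-cyclic = λ {x} → ⊥-elim (Fin.¬Fin0 x) }
linearization {suc m} isC = record
  { rank = rank ; rank-injective = rank-injective ; rank-cyclic = rank-cyclic }
  where open CircularOrderingProperties isC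
        open CutAt zero

SPmaps-mono : ∀ {m G} {C C′ : Fin (n G) → Fin (n G) → Fin (n G) → Set} →
              (∀ {x y z} → C x y z → C′ x y z) → SPmaps m G C → SPmaps m G C′
SPmaps-mono {m} C⇒C′ (u , w , adj , adj-last , u-injective , ordered , closing) =
  u , w , adj , adj-last , u-injective , (λ i j 0<i i<j → C⇒C′ {u zero} {u i} {u j} (ordered i j 0<i i<j))
  , Sum.map₂ (λ (w-fresh , back) → w-fresh , C⇒C′ {u (fromℕ m)} {w} {u zero} back) closing

module LevelsOfKeys {A : Set} (key level : A → ℕ)
                    (key<⇒level≤ : ∀ {a c} → key a < key c → level a ≤ level c) where

  key<∧level≢⇒level< : ∀ {a c} → key a < key c → level a ≢ level c → level a < level c
  key<∧level≢⇒level< ka<kc = ≤∧≢⇒< (key<⇒level≤ ka<kc)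

  level-cyclic : ∀ {a x c} → level a ≢ level x → level x ≢ level c → level a ≢ level c →
                 Cyclic⟨ key ⟩ a x c → Cyclic⟨ level ⟩ a x c
  level-cyclic a≢x x≢c a≢c (inj₁ (a<x , x<c)) =
    inj₁ (key<∧level≢⇒level< a<x a≢x , key<∧level≢⇒level< x<c x≢c)
  level-cyclic a≢x x≢c a≢c (inj₂ (inj₁ (x<c , c<a))) =
    inj₂ (inj₁ (key<∧level≢⇒level< x<c x≢c , key<∧level≢⇒level< c<a (a≢c ∘ sym)))
  level-cyclic a≢x x≢c a≢c (inj₂ (inj₂ (c<a , a<x))) =
    inj₂ (inj₂ (key<∧level≢⇒level< c<a (a≢c ∘ sym) , key<∧level≢⇒level< a<x a≢x))

  cyclic-sameLevel : ∀ {a x c} → Cyclic⟨ key ⟩ a x c → level a ≡ level c →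
                     level x ≡ level a ⊎ key c < key a
  cyclic-sameLevel (inj₁ (a<x , x<c)) la≡lc =
    inj₁ (≤-antisym (≤-trans (key<⇒level≤ x<c) (≤-reflexive (sym la≡lc))) (key<⇒level≤ a<x))
  cyclic-sameLevel (inj₂ (inj₁ (_ , c<a))) _ = inj₂ c<a
  cyclic-sameLevel (inj₂ (inj₂ (c<a , _))) _ = inj₂ c<a

  sameLevel-arcs : ∀ {a x c y} → Cyclic⟨ key ⟩ a x c → Cyclic⟨ key ⟩ c y a → level a ≡ level c →
                   level x ≡ level a ⊎ level y ≡ level c
  sameLevel-arcs axc cya la≡lc with cyclic-sameLevel axc la≡lc | cyclic-sameLevel cya (sym la≡lc)
  ... | inj₁ lx≡la | _          = inj₁ lx≡la
  ... | inj₂ _     | inj₁ ly≡lc = inj₂ ly≡lc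
  ... | inj₂ kc<ka | inj₂ ka<kc = ⊥-elim (<-asym kc<ka ka<kc)

module Transfer {H G : Graph} (φ : Hom H G) (rank : Fin (n G) → ℕ)
                (rank-injective : Injective _≡_ _≡_ rank) where
  open Hom φ

  level : Fin (n H) → ℕ
  level a = rank (map a)

  key : Fin (n H) → ℕ
  key a = level a * n H + toℕ a

  level<⇒key< : ∀ {a c} → level a < level c → key a < key c
  level<⇒key< {a} {c} la<lc = begin-strict
    level a * n H + toℕ a  <⟨ +-monoʳ-< (level a * n H) (Fin.toℕ<n a) ⟩
    level a * n H + n H    ≡⟨ +-comm (level a * n H) (n H) ⟩
    suc (level a) * n H    ≤⟨ *-monoˡ-≤ (n H) la<lc ⟩
    level c * n H          ≤⟨ m≤m+n (level c * n H) (toℕ c) ⟩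
    key c                  ∎
    where open ≤-Reasoning

  key<⇒level≤ : ∀ {a c} → key a < key c → level a ≤ level c
  key<⇒level≤ ka<kc = ≮⇒≥ λ lc<la → <-asym ka<kc (level<⇒key< lc<la)

  key-injective : Injective _≡_ _≡_ key
  key-injective {a} {c} ka≡kc with <-cmp (level a) (level c)
  ... | tri< la<lc _ _ = ⊥-elim (<-irrefl ka≡kc (level<⇒key< la<lc))
  ... | tri> _ _ lc<la = ⊥-elim (<-irrefl (sym ka≡kc) (level<⇒key< lc<la))
  ... | tri≈ _ la≡lc _ = Fin.toℕ-injective (+-cancelˡ-≡ (level a * n H) _ _
                           (trans ka≡kc (cong (λ l → l * n H + toℕ c) (sym la≡lc))))

  adjacent⇒level≢ : ∀ {a c} → Adj H a c → level a ≢ level c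
  adjacent⇒level≢ {a} a~c la≡lc =
    irrefl G (subst (Adj G (map a)) (sym (rank-injective la≡lc)) (pres a~c))

  open LevelsOfKeys key level key<⇒level≤
  open CircularOrderingProperties (cyclic-isCircularOrdering key-injective) using (C-shift; C-irrefl₁₃)

  module Walk {m : ℕ} (u : Fin (suc m) → Fin (n H)) (w : Fin (n H))
              (adj : ∀ i → Adj H (u (inject₁ i)) (u (suc i)))
              (adj-last : Adj H (u (fromℕ m)) w)
              (ordered : ∀ i j → 0 < toℕ i → i Fin.< j → Cyclic⟨ key ⟩ (u zero) (u i) (u j))
              (closing : w ≡ u zero ⊎ ((∀ i → w ≢ u i) × Cyclic⟨ key ⟩ (u (fromℕ m)) w (u zero))) where

    inject₁<suc : ∀ (i : Fin m) → inject₁ i Fin.< suc i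
    inject₁<suc i = Fin.≤̄⇒inject₁< Fin.≤-refl

    inject₁<fromℕ : ∀ (i : Fin m) → inject₁ i Fin.< fromℕ m
    inject₁<fromℕ i = subst (toℕ (inject₁ i) <_) (sym (Fin.toℕ-fromℕ m)) (Fin.inject₁ℕ< i)

    next-vertex : ∀ j → 0 < toℕ j →
                  Adj H (u j) (u zero) ⊎ ∃[ y ] Adj H (u j) y × Cyclic⟨ key ⟩ (u j) y (u zero)
    next-vertex j pos with view j
    next-vertex _ pos | ‵inject₁ i =
      inj₂ (u (suc i) , adj i , cyclic-rotate (ordered (inject₁ i) (suc i) pos (inject₁<suc i)))
    next-vertex _ pos | ‵fromℕ = Sum.[ (λ w≡u₀ → inj₁ (subst (Adj H (u (fromℕ m))) w≡u₀ adj-last))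
                                     , (λ (_ , back) → inj₂ (w , adj-last , back)) ] closing

    start-level-unique : ∀ j → 0 < toℕ j → level (u zero) ≢ level (u j)
    start-level-unique (suc zero)    _ l₀≡l₁ = adjacent⇒level≢ (adj zero) l₀≡l₁
    start-level-unique (suc (suc j)) _ l₀≡lⱼ with next-vertex (suc (suc j)) z<s
    ... | inj₁ back            = adjacent⇒level≢ back (sym l₀≡lⱼ)
    ... | inj₂ (y , step , arc) with sameLevel-arcs (ordered (suc zero) (suc (suc j)) z<s (s<s z<s)) arc l₀≡lⱼ
    ...   | inj₁ l₁≡l₀ = adjacent⇒level≢ (adj zero) (sym l₁≡l₀)
    ...   | inj₂ ly≡lⱼ = adjacent⇒level≢ step (sym ly≡lⱼ)

    inner-level-unique : ∀ i j → 0 < toℕ i → i Fin.< j → level (u i) ≢ level (u j)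
    inner-level-unique i j pos i<j li≡lj with view i
    ... | ‵fromℕ     = <⇒≱ i<j (Fin.≤fromℕ j)
    ... | ‵inject₁ i′ with Fin.<-cmp (suc i′) j
    ...   | tri≈ _ refl _ = adjacent⇒level≢ (adj i′) li≡lj
    ...   | tri> _ _ j<i+1 =
      <⇒≱ (subst (_< toℕ j) (Fin.toℕ-inject₁ i′) i<j) (s≤s⁻¹ j<i+1)
    ...   | tri< i+1<j _ _ =
      Sum.[ (λ lᵢ₊₁≡lᵢ → adjacent⇒level≢ (adj i′) (sym lᵢ₊₁≡lᵢ))
          , start-level-unique j (<-trans pos i<j) ]
          (sameLevel-arcs arc-via-next arc-via-start li≡lj)
      where
      arc-via-next : Cyclic⟨ key ⟩ (u (inject₁ i′)) (u (suc i′)) (u j)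
      arc-via-next = C-shift (ordered (inject₁ i′) (suc i′) pos (inject₁<suc i′)) (ordered (suc i′) j z<s i+1<j)

      arc-via-start : Cyclic⟨ key ⟩ (u j) (u zero) (u (inject₁ i′))
      arc-via-start = cyclic-rotate (cyclic-rotate (ordered (inject₁ i′) j pos i<j))

    level-unique : ∀ i j → i Fin.< j → level (u i) ≢ level (u j)
    level-unique zero    j = start-level-unique j
    level-unique (suc i) j = inner-level-unique (suc i) j z<s

    walk-levels-injective : ∀ {i j} → level (u i) ≡ level (u j) → i ≡ j
    walk-levels-injective {i} {j} li≡lj with Fin.<-cmp i j
    ... | tri< i<j _ _ = ⊥-elim (level-unique i j i<j li≡lj)
    ... | tri≈ _ i≡j _ = i≡j
    ... | tri> _ _ j<i = ⊥-elim (level-unique j i j<i (sym li≡lj))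

    ordered-levels : ∀ i j → 0 < toℕ i → i Fin.< j → Cyclic⟨ level ⟩ (u zero) (u i) (u j)
    ordered-levels i j pos i<j =
      level-cyclic (level-unique zero i pos) (level-unique i j i<j)
                   (level-unique zero j (<-trans pos i<j)) (ordered i j pos i<j)

    end-level-fresh : Cyclic⟨ key ⟩ (u (fromℕ m)) w (u zero) → level w ≢ level (u zero) →
                      ∀ i → level w ≢ level (u i)
    end-level-fresh _    lw≢l₀ zero    = lw≢l₀
    end-level-fresh back lw≢l₀ (suc i) = fresh (suc i) z<s
      where
      start-last-end : Cyclic⟨ key ⟩ (u zero) (u (fromℕ m)) w
      start-last-end = cyclic-rotate (cyclic-rotate back)

      fresh : ∀ i → 0 < toℕ i → level w ≢ level (u i)
      fresh i pos lw≡li with view i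
      ... | ‵fromℕ      = adjacent⇒level≢ adj-last (sym lw≡li)
      ... | ‵inject₁ i′ =
        Sum.[ (λ lₘ≡lᵢ → Fin.<-irrefl (sym (walk-levels-injective lₘ≡lᵢ)) (inject₁<fromℕ i′))
            , (λ l₀≡lw → lw≢l₀ (sym l₀≡lw)) ]
            (sameLevel-arcs (C-shift start-i-last start-last-end)
                            (cyclic-rotate (cyclic-rotate (cyclic-trans start-i-last start-last-end)))
                            (sym lw≡li))
        where
        start-i-last : Cyclic⟨ key ⟩ (u zero) (u (inject₁ i′)) (u (fromℕ m))
        start-i-last = ordered (inject₁ i′) (fromℕ m) pos (inject₁<fromℕ i′)

    closing-image : Cyclic⟨ key ⟩ (u (fromℕ m)) w (u zero) →
                    map w ≡ map (u zero)
                    ⊎ ((∀ i → map w ≢ map (u i)) × Cyclic⟨ rank ⟩ (map (u (fromℕ m))) (map w) (map (u zero)))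
    closing-image back with map w Fin.≟ map (u zero)
    ... | yes fw≡fu₀ = inj₁ fw≡fu₀
    ... | no  fw≢fu₀ =
      inj₂ ( (λ i → end-level-fresh back lw≢l₀ i ∘ cong rank)
           , level-cyclic (adjacent⇒level≢ adj-last) lw≢l₀ lₘ≢l₀ back )
      where
      lw≢l₀ : level w ≢ level (u zero)
      lw≢l₀ = fw≢fu₀ ∘ rank-injective

      lₘ≢l₀ : level (u (fromℕ m)) ≢ level (u zero)
      lₘ≢l₀ lₘ≡l₀ = C-irrefl₁₃ (subst (λ i → Cyclic⟨ key ⟩ (u i) w (u zero)) (walk-levels-injective lₘ≡l₀) back)

  transfer : ∀ m → SPmaps m H Cyclic⟨ key ⟩ → SPmaps m G Cyclic⟨ rank ⟩
  -- The image walk is injective because its levels are.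
  transfer m (u , w , adj , adj-last , _ , ordered , closing) =
      map ∘ u , map w , (λ i → pres (adj i)) , pres adj-last
    , walk-levels-injective ∘ cong rank , ordered-levels
    , Sum.[ inj₁ ∘ cong map , closing-image ∘ proj₂ ] closing
    where open Walk u w adj adj-last ordered closing

mainTheorem17 : (k : ℕ) → 2 ≤ k → (G H : Graph) → InClass k G → Hom H G → InClass k H
mainTheorem17 0             ()      _ _ _ _
mainTheorem17 1             (s≤s ()) _ _ _ _
mainTheorem17 (suc (suc m)) _ G H ((C , isC) , SP↛G) φ =
  (Cyclic⟨ key ⟩ , cyclic-isCircularOrdering key-injective) ,
  λ SP→H → SP↛G (SPmaps-mono {m} {G} {Cyclic⟨ rank ⟩} rank-cyclic (transfer m SP→H))
  where
  open Linearization (linearization isC)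
  open Transfer φ rank rank-injective
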